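{- Let $n\geq 2$ and $v\geq 2$, and let $G$ be a maximal weakly $(n,v)$-clique-partitioned graph. Then $G$ is isomorphic to the graph $\Gamma'(n,v)$.
   Context: A $v$-clique is a set of $v$ pairwise adjacent vertices. A graph of order $nv$ is weakly $(n,v)$-clique-partitioned if its vertex set can be decomposed in a unique way into $n$ vertex-disjoint $v$-cliques. Every weakly $(n,v)$-clique-partitioned graph has at most $\binom{nv}{2}-\frac{n(n-1)v}{2}$ edges; one is called maximal if it has exactly this many edges. The graph $\Gamma'(n,v)$ has vertex set $\{(i,j):0\leq i\leq n-1,\ 0\leq j\leq v-1\}$ and is obtained from the complete graph on this vertex set by removing all edges joining $(i,0)$ to $(k,\ell)$ for all $0\leq i\leq n-2$, $i<k\leq n-1$, $0\leq \ell\leq v-1$. -}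

module Defs where

open import Data.Nat using (ℕ; zero; suc; _+_; _*_; _∸_; _<_)
open import Data.Nat.DivMod using (_/_)
open import Data.Nat.Combinatorics using (_C_)
open import Data.Bool using (Bool; true; false; if_then_else_; _∧_; not)
open import Data.Fin using (Fin; zero; suc; toℕ)
open import Data.Fin.Properties using () renaming (_≟_ to _≟ᶠ_)
open import Data.Nat.Properties using () renaming (_<?_ to _<?ℕ_)
open import Data.Product using (_×_; _,_; Σ-syntax; ∃-syntax)
open import Data.Product.Properties using (≡-dec)
open import Relation.Nullary using (¬_; yes; no)
open import Data.Empty using (⊥-elim)
open import Data.Bool.Properties using (∨-comm)
import Relation.Binary.PropositionalEquality as Eq
open import Relation.Nullary.Decidable using (⌊_⌋)
open import Relation.Binary.PropositionalEquality using (_≡_; _≢_; refl)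
open import Function.Bundles using (Bijection; _⤖_)
open import Level using (0ℓ)

record Graph (V : Set) : Set where
  field
    adj   : V → V → Bool
    sym   : ∀ x y → adj x y ≡ adj y x
    irrefl : ∀ x → adj x x ≡ false
open Graph public

sumFin : ∀ {N} → (Fin N → ℕ) → ℕ
sumFin {zero}  f = 0
sumFin {suc N} f = f zero + sumFin (λ i → f (suc i))

edgeCount : ∀ {N} → Graph (Fin N) → ℕ
edgeCount G = sumFin (λ x → sumFin (λ y →
  if ⌊ toℕ x <?ℕ toℕ y ⌋ ∧ adj G x y then 1 else 0))

-- A decomposition of the vertex set Fin (n * v) into n vertex-disjoint v-cliques,
-- given by a block labelling f : vertex ↦ block index in Fin n.
IsCliquePartition : (n v : ℕ) → Graph (Fin (n * v)) → (Fin (n * v) → Fin n) → Set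
IsCliquePartition n v G f =
  (∀ (p : Fin n) → sumFin (λ x → if ⌊ f x ≟ᶠ p ⌋ then 1 else 0) ≡ v)
  × (∀ x y → f x ≡ f y → x ≢ y → adj G x y ≡ true)

-- Two labellings describe the same decomposition (same set of blocks).
SameDecomposition : ∀ {N n} → (Fin N → Fin n) → (Fin N → Fin n) → Set
SameDecomposition f g = ∀ x y → (f x ≡ f y → g x ≡ g y) × (g x ≡ g y → f x ≡ f y)

WeaklyCliquePartitioned : (n v : ℕ) → Graph (Fin (n * v)) → Set
WeaklyCliquePartitioned n v G =
  Σ[ f ∈ (Fin (n * v) → Fin n) ] (IsCliquePartition n v G f
    × (∀ g → IsCliquePartition n v G g → SameDecomposition f g))

MaximalWeaklyCliquePartitioned : (n v : ℕ) → Graph (Fin (n * v)) → Set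
MaximalWeaklyCliquePartitioned n v G =
  WeaklyCliquePartitioned n v G
  × edgeCount G ≡ ((n * v) C 2) ∸ ((n * (n ∸ 1) * v) / 2)

_≅_ : ∀ {V W : Set} → Graph V → Graph W → Set
_≅_ {V} {W} G H = Σ[ σ ∈ V ⤖ W ] (∀ x y → adj G x y ≡ adj H (Bijection.to σ x) (Bijection.to σ y))

-- The graph Γ'(n,v) on vertices (i,j), i ∈ Fin n, j ∈ Fin v:
-- complete graph minus all edges (i,0)–(k,ℓ) with i < k.
removed : ∀ {n v} → Fin n × Fin v → Fin n × Fin v → Bool
removed {v = zero} _ _ = false
removed {v = suc v} (i , j) (k , l) =
  (⌊ j ≟ᶠ zero ⌋ ∧ ⌊ toℕ i <?ℕ toℕ k ⌋) Data.Bool.∨ (⌊ l ≟ᶠ zero ⌋ ∧ ⌊ toℕ k <?ℕ toℕ i ⌋)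

Γadj : ∀ {n v} → Fin n × Fin v → Fin n × Fin v → Bool
Γadj p q = not ⌊ ≡-dec _≟ᶠ_ _≟ᶠ_ p q ⌋ ∧ not (removed p q)

removed-sym : ∀ {n v} (p q : Fin n × Fin v) → removed p q ≡ removed q p
removed-sym {v = zero} _ _ = refl
removed-sym {v = suc v} (i , j) (k , l) =
  ∨-comm (⌊ j ≟ᶠ zero ⌋ ∧ ⌊ toℕ i <?ℕ toℕ k ⌋) (⌊ l ≟ᶠ zero ⌋ ∧ ⌊ toℕ k <?ℕ toℕ i ⌋)

eqb-sym : ∀ {n v} (p q : Fin n × Fin v) → ⌊ ≡-dec _≟ᶠ_ _≟ᶠ_ p q ⌋ ≡ ⌊ ≡-dec _≟ᶠ_ _≟ᶠ_ q p ⌋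
eqb-sym p q with ≡-dec _≟ᶠ_ _≟ᶠ_ p q | ≡-dec _≟ᶠ_ _≟ᶠ_ q p
... | yes _ | yes _ = refl
... | no _  | no _  = refl
... | yes e | no ne = ⊥-elim (ne (Eq.sym e))
... | no ne | yes e = ⊥-elim (ne (Eq.sym e))

eqb-refl : ∀ {n v} (p : Fin n × Fin v) → ⌊ ≡-dec _≟ᶠ_ _≟ᶠ_ p p ⌋ ≡ true
eqb-refl p with ≡-dec _≟ᶠ_ _≟ᶠ_ p p
... | yes _ = refl
... | no ne = ⊥-elim (ne refl)

Γ′ : (n v : ℕ) → Graph (Fin n × Fin v)
Γ′ n v = record
  { adj = Γadj
  ; sym = λ p q → Eq.cong₂ (λ a b → not a ∧ not b) (eqb-sym p q) (removed-sym p q)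
  ; irrefl = λ p → Eq.cong (λ a → not a ∧ not (removed p p)) (eqb-refl p)
  }

-- Let f be the unique partition of G into v-cliques (the blocks). Reassigning vertices to
-- blocks so that every block is still a v-clique would give a second partition, so no
-- such reassignment exists; the ones used are exchanges of equally large sets between
-- two blocks and rotations of three vertices through three blocks. Exchanging single
-- vertices shows that there are at least v non-edges between any two blocks, and
-- maximality leaves room for exactly v. With exactly v, a second exchange argument shows
-- that all of them meet one vertex of one of the two blocks, its hub, which is adjacent
-- to nothing in the other block. "p has a hub towards q" is a tournament on the blocks,
-- and rotations show that it has no 3-cycles and that each block has at most one hub.
-- Numbering the blocks along this linear order, and the vertices of each block starting
-- with its hub, gives an isomorphism onto Γ′(n,v).

module Submission where

open import Defs hiding (sym)

open import Data.Bool using (Bool; true; false; if_then_else_; _∧_; _∨_; not)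
open import Data.Bool.Properties
  using (∧-zeroʳ; ∧-identityʳ; ∨-identityʳ; ∨-zeroʳ; ∧-conicalˡ; ∧-conicalʳ; not-injective; T-≡)
  renaming (_≟_ to _≟ᵇ_)
open import Data.Empty using (⊥; ⊥-elim)
open import Data.Fin using (Fin; zero; suc; toℕ; fromℕ<; punchOut; combine)
open import Data.Fin.Properties
  using (any?; all?; toℕ-injective; toℕ<n; toℕ-fromℕ<; injective⇒≤; punchOut-injective; combine-injective)
  renaming (_≟_ to _≟ᶠ_)
open import Data.Nat
open import Data.Nat.Combinatorics using (_C_; nC1≡n; nCk+nC[k+1]≡[n+1]C[k+1])
open import Data.Nat.DivMod using (_/_; m/n*n≤m)
open import Data.Nat.Properties
open import Data.Product using (_×_; _,_; ∃; proj₁; proj₂; uncurry)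
open import Data.Product.Properties using (≡-dec)
open import Data.Sum using (_⊎_; inj₁; inj₂)
open import Function using (_∘_; _⟨_⟩_)
open import Function.Bundles using (Equivalence; mk⤖)
open import Relation.Binary.Definitions using (Transitive; Decidable; tri<; tri≈; tri>)
open import Relation.Binary.PropositionalEquality
open import Relation.Nullary using (¬_; Dec; yes; no)
open import Relation.Nullary.Decidable
  using (⌊_⌋; isYes≗does; dec-true; dec-false; toWitness; _×-dec_; _→-dec_; ¬?; map′)

open import Algebra.Properties.CommutativeMonoid.Sum +-0-commutativeMonoid
  using (sum; ∑-distrib-+; ∑-comm)

χ : Bool → ℕ
χ b = if b then 1 else 0

true≢false : true ≢ false
true≢false ()

χ-positive : ∀ {b} → 0 < χ b → b ≡ true
χ-positive {true} _ = refl

module _ {P : Set} (P? : Dec P) where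

  ⌊⌋-true : P → ⌊ P? ⌋ ≡ true
  ⌊⌋-true p = trans (isYes≗does P?) (dec-true P? p)

  ⌊⌋-false : ¬ P → ⌊ P? ⌋ ≡ false
  ⌊⌋-false ¬p = trans (isYes≗does P?) (dec-false P? ¬p)

  ⌊⌋-sound : ⌊ P? ⌋ ≡ true → P
  ⌊⌋-sound eq = toWitness (Equivalence.from T-≡ eq)

  ⌊⌋-sound-false : ⌊ P? ⌋ ≡ false → ¬ P
  ⌊⌋-sound-false eq p = true≢false (trans (sym (⌊⌋-true p)) eq)

_==_ : ∀ {N} → Fin N → Fin N → Bool
x == y = ⌊ x ≟ᶠ y ⌋

module _ {N : ℕ} {x y : Fin N} where

  ==-true : x ≡ y → x == y ≡ true
  ==-true = ⌊⌋-true (x ≟ᶠ y)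

  ==-false : x ≢ y → x == y ≡ false
  ==-false = ⌊⌋-false (x ≟ᶠ y)

  ==-sound : x == y ≡ true → x ≡ y
  ==-sound = ⌊⌋-sound (x ≟ᶠ y)

  ==-sound-false : x == y ≡ false → x ≢ y
  ==-sound-false = ⌊⌋-sound-false (x ≟ᶠ y)

==-refl : ∀ {N} (x : Fin N) → x == x ≡ true
==-refl x = ==-true refl

==-sym : ∀ {N} (x y : Fin N) → x == y ≡ y == x
==-sym x y with x ≟ᶠ y | y ≟ᶠ x
... | yes _   | yes _   = refl
... | no  _   | no  _   = refl
... | yes x≡y | no  y≢x = ⊥-elim (y≢x (sym x≡y))
... | no  x≢y | yes y≡x = ⊥-elim (x≢y (sym y≡x))

==-suc : ∀ {N} (i j : Fin N) → (suc i == suc j) ≡ (i == j)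
==-suc i j with i ≟ᶠ j
... | yes _ = refl
... | no  _ = refl

_<ᶠ_ : ∀ {N} → Fin N → Fin N → Bool
x <ᶠ y = ⌊ toℕ x <? toℕ y ⌋

<ᶠ-suc : ∀ {N} (x y : Fin N) → (suc x <ᶠ suc y) ≡ (x <ᶠ y)
<ᶠ-suc x y with toℕ x <? toℕ y
... | yes x<y = ⌊⌋-true (suc (toℕ x) <? suc (toℕ y)) (s<s x<y)
... | no  x≮y = ⌊⌋-false (suc (toℕ x) <? suc (toℕ y)) (x≮y ∘ s<s⁻¹)

m∸[m∸n]≤n : ∀ m n → m ∸ (m ∸ n) ≤ n
m∸[m∸n]≤n m n with ≤-total n m
... | inj₁ n≤m = ≤-reflexive (m∸[m∸n]≡n n≤m)
... | inj₂ m≤n rewrite m≤n⇒m∸n≡0 m≤n = m≤n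

<ᵇ-zero : ∀ a → (a <ᵇ 0) ≡ false
<ᵇ-zero zero    = refl
<ᵇ-zero (suc a) = refl

<ᵇ-suc : ∀ a t → (a <ᵇ suc t) ≡ (a <ᵇ t) ∨ (a ≡ᵇ t)
<ᵇ-suc zero    zero    = refl
<ᵇ-suc zero    (suc t) = refl
<ᵇ-suc (suc a) zero    = cong (_∨ false) (sym (<ᵇ-zero a))
<ᵇ-suc (suc a) (suc t) = <ᵇ-suc a t

-- Finite sums

sumFin≡sum : ∀ {N} (f : Fin N → ℕ) → sumFin f ≡ sum f
sumFin≡sum {zero}  f = refl
sumFin≡sum {suc N} f = cong (f zero +_) (sumFin≡sum (f ∘ suc))

sumFin-cong : ∀ {N} {f g : Fin N → ℕ} → (∀ i → f i ≡ g i) → sumFin f ≡ sumFin g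
sumFin-cong {zero}  f≗g = refl
sumFin-cong {suc N} f≗g = cong₂ _+_ (f≗g zero) (sumFin-cong (f≗g ∘ suc))

sumFin-mono : ∀ {N} {f g : Fin N → ℕ} → (∀ i → f i ≤ g i) → sumFin f ≤ sumFin g
sumFin-mono {zero}  f≤g = z≤n
sumFin-mono {suc N} f≤g = +-mono-≤ (f≤g zero) (sumFin-mono (f≤g ∘ suc))

sumFin-const : ∀ N c → sumFin {N} (λ _ → c) ≡ N * c
sumFin-const zero    c = refl
sumFin-const (suc N) c = cong (c +_) (sumFin-const N c)

sumFin-zero : ∀ {N} {f : Fin N → ℕ} → (∀ i → f i ≡ 0) → sumFin f ≡ 0
sumFin-zero {N} f≗0 = trans (sumFin-cong f≗0) (trans (sumFin-const N 0) (*-zeroʳ N))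

sumFin-distrib : ∀ {N} (f g : Fin N → ℕ) → sumFin (λ i → f i + g i) ≡ sumFin f + sumFin g
sumFin-distrib f g = begin
  sumFin (λ i → f i + g i)  ≡⟨ sumFin≡sum (λ i → f i + g i) ⟩
  sum (λ i → f i + g i)     ≡⟨ ∑-distrib-+ f g ⟩
  sum f + sum g             ≡⟨ cong₂ _+_ (sumFin≡sum f) (sumFin≡sum g) ⟨
  sumFin f + sumFin g       ∎
  where open ≡-Reasoning

sumFin-comm : ∀ {M N} (f : Fin M → Fin N → ℕ) →
  sumFin (λ i → sumFin (λ j → f i j)) ≡ sumFin (λ j → sumFin (λ i → f i j))
sumFin-comm f = begin
  sumFin (λ i → sumFin (f i))            ≡⟨ sumFin-cong (λ i → sumFin≡sum (f i)) ⟩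
  sumFin (λ i → sum (f i))               ≡⟨ sumFin≡sum (λ i → sum (f i)) ⟩
  sum (λ i → sum (f i))                  ≡⟨ ∑-comm f ⟩
  sum (λ j → sum (λ i → f i j))          ≡⟨ sumFin≡sum (λ j → sum (λ i → f i j)) ⟨
  sumFin (λ j → sum (λ i → f i j))       ≡⟨ sumFin-cong (λ j → sumFin≡sum (λ i → f i j)) ⟨
  sumFin (λ j → sumFin (λ i → f i j))    ∎
  where open ≡-Reasoning

term≤sumFin : ∀ {N} (f : Fin N → ℕ) i → f i ≤ sumFin f
term≤sumFin f zero    = m≤m+n _ _
term≤sumFin f (suc i) = ≤-trans (term≤sumFin (f ∘ suc) i) (m≤n+m _ (f zero))

sumFin-positive : ∀ {N} (f : Fin N → ℕ) → 0 < sumFin f → ∃ λ i → 0 < f i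
sumFin-positive {suc N} f pos with f zero in eq
... | suc _ = zero , subst (0 <_) (sym eq) z<s
... | zero  with sumFin-positive (f ∘ suc) pos
...   | i , fi>0 = suc i , fi>0

sumFin-tight : ∀ {N} {f g : Fin N → ℕ} → (∀ i → g i ≤ f i) → sumFin f ≤ sumFin g → ∀ i → f i ≡ g i
sumFin-tight {suc N} {f} {g} g≤f Σf≤Σg zero = ≤-antisym
  (+-cancelʳ-≤ (sumFin (f ∘ suc)) _ _
    (≤-trans Σf≤Σg (+-monoʳ-≤ (g zero) (sumFin-mono (g≤f ∘ suc)))))
  (g≤f zero)
sumFin-tight {suc N} {f} {g} g≤f Σf≤Σg (suc i) = sumFin-tight (g≤f ∘ suc)
  (+-cancelˡ-≤ (g zero) _ _ (≤-trans (+-monoˡ-≤ _ (g≤f zero)) Σf≤Σg)) i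

sumFin≡0⇒≡0 : ∀ {N} (f : Fin N → ℕ) → sumFin f ≡ 0 → ∀ i → f i ≡ 0
sumFin≡0⇒≡0 {N} f Σf≡0 =
  sumFin-tight (λ _ → z≤n) (≤-reflexive (trans Σf≡0 (sym (sumFin-zero {N} λ _ → refl))))

sumFin-balance : ∀ {N} (a b c d : Fin N → ℕ) → (∀ i → a i + b i ≡ c i + d i) →
  sumFin b ≡ sumFin d → sumFin a ≡ sumFin c
sumFin-balance a b c d pointwise Σb≡Σd = +-cancelʳ-≡ (sumFin b) _ _ (begin
  sumFin a + sumFin b         ≡⟨ sumFin-distrib a b ⟨
  sumFin (λ i → a i + b i)    ≡⟨ sumFin-cong pointwise ⟩
  sumFin (λ i → c i + d i)    ≡⟨ sumFin-distrib c d ⟩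
  sumFin c + sumFin d         ≡⟨ cong (sumFin c +_) Σb≡Σd ⟨
  sumFin c + sumFin b         ∎)
  where open ≡-Reasoning

sumFin-*ʳ : ∀ {N} (f : Fin N → ℕ) c → sumFin (λ i → f i * c) ≡ sumFin f * c
sumFin-*ʳ {zero}  f c = refl
sumFin-*ʳ {suc N} f c = trans (cong (f zero * c +_) (sumFin-*ʳ (f ∘ suc) c)) (sym (*-distribʳ-+ c (f zero) _))

-- Counting

count : ∀ {N} → (Fin N → Bool) → ℕ
count P = sumFin (χ ∘ P)

_⊆_ : ∀ {N} → (Fin N → Bool) → (Fin N → Bool) → Set
P ⊆ Q = ∀ x → P x ≡ true → Q x ≡ true

sumFin-χ-∧ : ∀ {N} b (c : Fin N → Bool) → sumFin (λ y → χ (b ∧ c y)) ≡ (if b then count c else 0)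
sumFin-χ-∧     true  c = refl
sumFin-χ-∧ {N} false c = sumFin-zero {N} λ _ → refl

count-point : ∀ {N} (a : Fin N) → count (_== a) ≡ 1
count-point {suc N} zero    = cong suc (sumFin-zero {N} λ i → cong χ (==-false {x = suc i} {zero} λ ()))
count-point {suc N} (suc a) = trans
  (cong₂ _+_ (cong χ (==-false {x = zero} {suc a} λ ())) (sumFin-cong λ i → cong χ (==-suc i a)))
  (count-point a)

count-mono : ∀ {N} {P Q : Fin N → Bool} → P ⊆ Q → count P ≤ count Q
count-mono P⊆Q = sumFin-mono λ x → pointwise x (P⊆Q x)
  where
  pointwise : ∀ x {b c} → (b ≡ true → c ≡ true) → χ b ≤ χ c
  pointwise x {false} _ = z≤n
  pointwise x {true}  h rewrite h refl = ≤-refl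

count-< : ∀ {N} {P Q : Fin N → Bool} {a} → P ⊆ Q → Q a ≡ true → P a ≡ false → count P < count Q
count-< {P = P} {Q} {a} P⊆Q Qa Pa = begin
  suc (count P)                        ≡⟨ +-comm 1 (count P) ⟩
  count P + 1                          ≡⟨ cong (count P +_) (count-point a) ⟨
  count P + count (_== a)              ≡⟨ sumFin-distrib (χ ∘ P) (χ ∘ (_== a)) ⟨
  sumFin (λ x → χ (P x) + χ (x == a))  ≤⟨ sumFin-mono pointwise ⟩
  count Q                              ∎
  where
  open ≤-Reasoning
  pointwise : ∀ x → χ (P x) + χ (x == a) ≤ χ (Q x)
  pointwise x with x ≟ᶠ a
  ... | yes refl rewrite Pa | Qa = ≤-refl
  ... | no  _ with P x in Px
  ...   | false = z≤n
  ...   | true  rewrite P⊆Q x Px = ≤-refl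

count-two : ∀ {N} {P : Fin N → Bool} {u w} → u ≢ w → P u ≡ true → P w ≡ true → 2 ≤ count P
count-two {P = P} {u} {w} u≢w Pu Pw = begin
  2                                          ≡⟨ cong₂ _+_ (count-point u) (count-point w) ⟨
  count (_== u) + count (_== w)              ≡⟨ sumFin-distrib (χ ∘ (_== u)) (χ ∘ (_== w)) ⟨
  sumFin (λ x → χ (x == u) + χ (x == w))     ≤⟨ sumFin-mono pointwise ⟩
  count P                                    ∎
  where
  open ≤-Reasoning
  pointwise : ∀ x → χ (x == u) + χ (x == w) ≤ χ (P x)
  pointwise x with x ≟ᶠ u | x ≟ᶠ w
  ... | yes refl | yes refl = ⊥-elim (u≢w refl)
  ... | yes refl | no _     rewrite Pu = ≤-refl
  ... | no _     | yes refl rewrite Pw = ≤-refl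
  ... | no _     | no _     = z≤n

count-remove : ∀ {N} {Q : Fin N → Bool} {c} → Q c ≡ true →
  count (λ y → Q y ∧ not (y == c)) + 1 ≡ count Q
count-remove {N} {Q} {c} Qc = begin
  count Q∖c + 1                                   ≡⟨ cong (count Q∖c +_) (count-point c) ⟨
  count Q∖c + count (_== c)                       ≡⟨ sumFin-distrib (χ ∘ Q∖c) (χ ∘ (_== c)) ⟨
  sumFin (λ y → χ (Q∖c y) + χ (y == c))           ≡⟨ sumFin-cong pointwise ⟩
  count Q                                         ∎
  where
  open ≡-Reasoning
  Q∖c : Fin N → Bool
  Q∖c y = Q y ∧ not (y == c)
  pointwise : ∀ y → χ (Q y ∧ not (y == c)) + χ (y == c) ≡ χ (Q y)
  pointwise y with y ≟ᶠ c
  ... | yes refl rewrite Qc = refl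
  ... | no _ with Q y
  ...   | true  = refl
  ...   | false = refl

count-others : ∀ {N} (a : Fin N) → count (λ b → not (a == b)) ≡ N ∸ 1
count-others {N} a = begin
  count (λ b → not (a == b))                  ≡⟨ sumFin-cong (λ b → cong (χ ∘ not) (==-sym a b)) ⟩
  count (λ b → true ∧ not (b == a))           ≡⟨ m+n∸n≡m _ 1 ⟨
  count (λ b → true ∧ not (b == a)) + 1 ∸ 1
    ≡⟨ cong (_∸ 1) (count-remove {N} {Q = λ _ → true} {a} refl) ⟩
  count {N} (λ _ → true) ∸ 1
    ≡⟨ cong (_∸ 1) (trans (sumFin-const N 1) (*-identityʳ N)) ⟩
  N ∸ 1                                       ∎
  where open ≡-Reasoning

<ᶠ⇒≢ : ∀ {N} {x y : Fin N} → x <ᶠ y ≡ true → x ≢ y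
<ᶠ⇒≢ {x = x} x<y refl = <-irrefl refl (⌊⌋-sound (toℕ x <? toℕ x) x<y)

<ᶠ-connex : ∀ {N} {x y : Fin N} → x ≢ y → x <ᶠ y ≡ not (y <ᶠ x)
<ᶠ-connex {x = x} {y} x≢y with <-cmp (toℕ x) (toℕ y)
... | tri< x<y _ y≮x rewrite ⌊⌋-true (toℕ x <? toℕ y) x<y | ⌊⌋-false (toℕ y <? toℕ x) y≮x = refl
... | tri≈ _ x≡y _   = ⊥-elim (x≢y (toℕ-injective x≡y))
... | tri> x≮y _ y<x rewrite ⌊⌋-false (toℕ x <? toℕ y) x≮y | ⌊⌋-true (toℕ y <? toℕ x) y<x = refl

count-ordered-pairs : ∀ N → sumFin {N} (λ x → count (λ y → x <ᶠ y)) ≡ N C 2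
count-ordered-pairs zero    = refl
count-ordered-pairs (suc N) = begin
  (0 + count {N} (λ _ → true)) + sumFin {N} (λ x → 0 + count (λ y → suc x <ᶠ suc y))
    ≡⟨ cong₂ _+_ (trans (sumFin-const N 1) (*-identityʳ N))
                 (trans (sumFin-cong {N} λ x → sumFin-cong {N} λ y → cong χ (<ᶠ-suc x y))
                        (count-ordered-pairs N)) ⟩
  N + N C 2        ≡⟨ cong (_+ N C 2) (nC1≡n N) ⟨
  N C 1 + N C 2    ≡⟨ nCk+nC[k+1]≡[n+1]C[k+1] N 1 ⟩
  suc N C 2        ∎
  where open ≡-Reasoning

count-toℕ≡ᵇ : ∀ {N} t → count {N} (λ x → toℕ x ≡ᵇ t) ≤ 1
count-toℕ≡ᵇ {zero}  t       = z≤n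
count-toℕ≡ᵇ {suc N} zero    = ≤-reflexive (cong suc (sumFin-zero {N} λ _ → refl))
count-toℕ≡ᵇ {suc N} (suc t) = count-toℕ≡ᵇ {N} t

discrete-ivt : (h : ℕ → ℕ) → (∀ t → h (suc t) ≤ suc (h t)) →
  ∀ {m} K → h 0 ≤ m → m ≤ h K → ∃ λ t → h t ≡ m
discrete-ivt h step zero    h0≤m m≤hK = 0 , ≤-antisym h0≤m m≤hK
discrete-ivt h step {m} (suc K) h0≤m m≤hK with m ≤? h K
... | yes m≤hK′ = discrete-ivt h step K h0≤m m≤hK′
... | no  m≰hK′ = suc K , ≤-antisym (≤-trans (step K) (≰⇒> m≰hK′)) m≤hK

-- The elements of U below a threshold t, added to L, form sets whose size grows
-- by at most one with t, so some threshold gives size exactly k.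
exists-between : ∀ {N} (L U : Fin N → Bool) {k} → L ⊆ U → count L ≤ k → k ≤ count U →
  ∃ λ X → L ⊆ X × X ⊆ U × count X ≡ k
exists-between {N} L U {k} L⊆U L≤k k≤U =
  below t , (λ x Lx → cong (_∨ (U x ∧ (toℕ x <ᵇ t))) Lx) , below⊆U t , size≡k
  where
  below : ℕ → Fin N → Bool
  below t x = L x ∨ (U x ∧ (toℕ x <ᵇ t))

  size : ℕ → ℕ
  size t = count (below t)

  below⊆U : ∀ t → below t ⊆ U
  below⊆U t x with L x in Lx
  ... | true  = λ _ → L⊆U x Lx
  ... | false = ∧-conicalˡ (U x) _

  size₀≤k : size 0 ≤ k
  size₀≤k = ≤-trans (count-mono below₀⊆L) L≤k
    where
    below₀⊆L : below 0 ⊆ L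
    below₀⊆L x rewrite <ᵇ-zero (toℕ x) | ∧-zeroʳ (U x) | ∨-identityʳ (L x) = λ Lx → Lx

  k≤size-N : k ≤ size N
  k≤size-N = ≤-trans k≤U (count-mono U⊆below-N)
    where
    U⊆below-N : U ⊆ below N
    U⊆below-N x Ux rewrite Ux | Equivalence.to T-≡ (<⇒<ᵇ (toℕ<n x)) = ∨-zeroʳ (L x)

  χ-step : ∀ c b l e → χ (c ∨ (b ∧ (l ∨ e))) ≤ χ (c ∨ (b ∧ l)) + χ e
  χ-step true  b     l     e = s≤s z≤n
  χ-step false false l     e = z≤n
  χ-step false true  true  e = s≤s z≤n
  χ-step false true  false e = ≤-refl

  step : ∀ t → size (suc t) ≤ suc (size t)
  step t = begin
    size (suc t)                                           ≤⟨ sumFin-mono pointwise ⟩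
    sumFin (λ x → χ (below t x) + χ (toℕ x ≡ᵇ t))
      ≡⟨ sumFin-distrib (χ ∘ below t) (λ (x : Fin N) → χ (toℕ x ≡ᵇ t)) ⟩
    size t + count {N} (λ x → toℕ x ≡ᵇ t)                  ≤⟨ +-monoʳ-≤ (size t) (count-toℕ≡ᵇ {N} t) ⟩
    size t + 1                                             ≡⟨ +-comm (size t) 1 ⟩
    suc (size t)                                           ∎
    where
    open ≤-Reasoning
    pointwise : ∀ x → χ (below (suc t) x) ≤ χ (below t x) + χ (toℕ x ≡ᵇ t)
    pointwise x rewrite <ᵇ-suc (toℕ x) t = χ-step (L x) (U x) (toℕ x <ᵇ t) (toℕ x ≡ᵇ t)

  t : ℕ
  t = proj₁ (discrete-ivt size step N size₀≤k k≤size-N)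
  size≡k : size t ≡ k
  size≡k = proj₂ (discrete-ivt size step N size₀≤k k≤size-N)

injective⇒surjective : ∀ {K} (h : Fin K → Fin K) → (∀ {x y} → h x ≡ h y → x ≡ y) →
  ∀ y → ∃ λ x → h x ≡ y
injective⇒surjective {suc K} h h-inj y with any? (λ x → h x ≟ᶠ y)
... | yes hit  = hit
... | no  miss = ⊥-elim (1+n≰n (injective⇒≤ squeeze-injective))
  where
  squeeze : Fin (suc K) → Fin K
  squeeze x = punchOut {i = y} {j = h x} (λ y≡hx → miss (x , sym y≡hx))

  squeeze-injective : ∀ {a b} → squeeze a ≡ squeeze b → a ≡ b
  squeeze-injective {a} {b} eq =
    h-inj (punchOut-injective (λ e → miss (a , sym e)) (λ e → miss (b , sym e)) eq)

uncurry-combine-injective : ∀ {m k} {P Q : Fin m × Fin k} → uncurry combine P ≡ uncurry combine Q → P ≡ Q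
uncurry-combine-injective {P = i , j} {k , l} eq = uncurry (cong₂ _,_) (combine-injective i j k l eq)

module Position {N} {_≺_ : Fin N → Fin N → Set} (_≺?_ : Decidable _≺_)
  (≺-irrefl : ∀ {x} → ¬ x ≺ x) (≺-trans : Transitive _≺_)
  (≺-connex : ∀ {x y} → x ≢ y → x ≺ y ⊎ y ≺ x) (S : Fin N → Bool) where

  position : Fin N → ℕ
  position x = count (λ z → S z ∧ ⌊ z ≺? x ⌋)

  position-mono : ∀ {x y} → S x ≡ true → x ≺ y → position x < position y
  position-mono {x} {y} Sx x≺y = count-< below-x⊆below-y
    (cong₂ _∧_ Sx (⌊⌋-true (x ≺? y) x≺y))
    (cong (S x ∧_) (⌊⌋-false (x ≺? x) ≺-irrefl) ⟨ trans ⟩ ∧-zeroʳ (S x))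
    where
    below-x⊆below-y : (λ z → S z ∧ ⌊ z ≺? x ⌋) ⊆ (λ z → S z ∧ ⌊ z ≺? y ⌋)
    below-x⊆below-y z below with S z
    ... | true = ⌊⌋-true (z ≺? y) (≺-trans (⌊⌋-sound (z ≺? x) below) x≺y)

  position<count : ∀ {x} → S x ≡ true → position x < count S
  position<count {x} Sx = count-< (λ z → ∧-conicalˡ (S z) _) Sx
    (cong (S x ∧_) (⌊⌋-false (x ≺? x) ≺-irrefl) ⟨ trans ⟩ ∧-zeroʳ (S x))

  position-injective : ∀ {x y} → S x ≡ true → S y ≡ true → position x ≡ position y → x ≡ y
  position-injective {x} {y} Sx Sy eq with x ≟ᶠ y
  ... | yes x≡y = x≡y
  ... | no  x≢y with ≺-connex x≢y
  ...   | inj₁ x≺y = ⊥-elim (<-irrefl eq (position-mono Sx x≺y))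
  ...   | inj₂ y≺x = ⊥-elim (<-irrefl (sym eq) (position-mono Sy y≺x))

  position-minimum : ∀ {x} → (∀ z → S z ≡ true → ¬ z ≺ x) → position x ≡ 0
  position-minimum {x} minimal = sumFin-zero pointwise
    where
    pointwise : ∀ z → χ (S z ∧ ⌊ z ≺? x ⌋) ≡ 0
    pointwise z with S z in Sz
    ... | false = refl
    ... | true  rewrite ⌊⌋-false (z ≺? x) (minimal z Sz) = refl

-- The graph Γ′

Γadj-same-row : ∀ {n v} (i : Fin n) (j l : Fin v) → j ≢ l → Γadj (i , j) (i , l) ≡ true
Γadj-same-row {v = suc v} i j l j≢l
  rewrite ⌊⌋-false (≡-dec _≟ᶠ_ _≟ᶠ_ (i , j) (i , l)) (j≢l ∘ cong proj₂)
        | ⌊⌋-false (toℕ i <? toℕ i) (<-irrefl refl)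
        | ∧-zeroʳ ⌊ j ≟ᶠ zero ⌋ | ∧-zeroʳ ⌊ l ≟ᶠ zero ⌋ = refl

Γadj-lower-row : ∀ {n v} {i k : Fin n} (j l : Fin v) → toℕ i < toℕ k →
  Γadj (i , j) (k , l) ≡ not (toℕ j ≡ᵇ 0)
Γadj-lower-row {v = suc v} {i} {k} j l i<k
  rewrite ⌊⌋-false (≡-dec _≟ᶠ_ _≟ᶠ_ (i , j) (k , l)) (λ e → <-irrefl (cong (toℕ ∘ proj₁) e) i<k)
        | ⌊⌋-true (toℕ i <? toℕ k) i<k
        | ⌊⌋-false (toℕ k <? toℕ i) (<-asym i<k)
        | ∧-identityʳ ⌊ j ≟ᶠ zero ⌋ | ∧-zeroʳ ⌊ l ≟ᶠ zero ⌋ | ∨-identityʳ ⌊ j ≟ᶠ zero ⌋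
        = cong not (is-zero j)
  where
  is-zero : ∀ {m} (j : Fin (suc m)) → ⌊ j ≟ᶠ zero ⌋ ≡ (toℕ j ≡ᵇ 0)
  is-zero {m} zero = ⌊⌋-true (zero {m} ≟ᶠ zero) refl
  is-zero (suc j) = ⌊⌋-false (suc j ≟ᶠ zero) λ ()

module NonAdjacency {N} (G : Graph (Fin N)) where

  nonAdj : Fin N → Fin N → Bool
  nonAdj x y = not (x == y) ∧ not (adj G x y)

  nonAdj-sym : ∀ x y → nonAdj x y ≡ nonAdj y x
  nonAdj-sym x y = cong₂ (λ e a → not e ∧ not a) (==-sym x y) (Graph.sym G x y)

  nonAdj⇒nonadjacent : ∀ {x y} → nonAdj x y ≡ true → adj G x y ≡ false
  nonAdj⇒nonadjacent {x} {y} eq with x == y | adj G x y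
  ... | false | false = refl

  nonadjacent⇒nonAdj : ∀ {x y} → x ≢ y → adj G x y ≡ false → nonAdj x y ≡ true
  nonadjacent⇒nonAdj x≢y x≁y rewrite ==-false x≢y | x≁y = refl

  ¬nonAdj⇒adjacent : ∀ {x y} → x ≢ y → nonAdj x y ≡ false → adj G x y ≡ true
  ¬nonAdj⇒adjacent {x} {y} x≢y eq =
    not-injective (trans (cong (λ b → not b ∧ not (adj G x y)) (sym (==-false x≢y))) eq)

  nonEdgeCount : ℕ
  nonEdgeCount = sumFin (λ x → count (λ y → x <ᶠ y ∧ nonAdj x y))

  edgeCount+nonEdgeCount : edgeCount G + nonEdgeCount ≡ N C 2
  edgeCount+nonEdgeCount = begin
    edgeCount G + nonEdgeCount
      ≡⟨ sumFin-distrib (λ x → count (λ y → x <ᶠ y ∧ adj G x y))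
                        (λ x → count (λ y → x <ᶠ y ∧ nonAdj x y)) ⟨
    sumFin (λ x → count (λ y → x <ᶠ y ∧ adj G x y) + count (λ y → x <ᶠ y ∧ nonAdj x y))
      ≡⟨ sumFin-cong (λ x → trans
           (sym (sumFin-distrib (λ y → χ (x <ᶠ y ∧ adj G x y)) (λ y → χ (x <ᶠ y ∧ nonAdj x y))))
           (sumFin-cong (split x))) ⟩
    sumFin {N} (λ x → count (λ y → x <ᶠ y))
      ≡⟨ count-ordered-pairs N ⟩
    N C 2 ∎
    where
    open ≡-Reasoning
    split : ∀ x y → χ (x <ᶠ y ∧ adj G x y) + χ (x <ᶠ y ∧ nonAdj x y) ≡ χ (x <ᶠ y)
    split x y with x <ᶠ y in x<y
    ... | false = refl
    ... | true rewrite ==-false (<ᶠ⇒≢ x<y) with adj G x y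
    ...   | true  = refl
    ...   | false = refl

  nonAdjacentPairs : ℕ
  nonAdjacentPairs = sumFin (λ x → count (nonAdj x))

  nonAdjacentPairs≡2*nonEdgeCount : nonAdjacentPairs ≡ nonEdgeCount + nonEdgeCount
  nonAdjacentPairs≡2*nonEdgeCount = begin
    nonAdjacentPairs
      ≡⟨ sumFin-cong (λ x → trans (sumFin-cong (split x))
           (sumFin-distrib (λ y → χ (x <ᶠ y ∧ nonAdj x y)) (λ y → χ (y <ᶠ x ∧ nonAdj x y)))) ⟩
    sumFin (λ x → count (λ y → x <ᶠ y ∧ nonAdj x y) + count (λ y → y <ᶠ x ∧ nonAdj x y))
      ≡⟨ sumFin-distrib (λ x → count (λ y → x <ᶠ y ∧ nonAdj x y))
                        (λ x → count (λ y → y <ᶠ x ∧ nonAdj x y)) ⟩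
    nonEdgeCount + sumFin (λ x → count (λ y → y <ᶠ x ∧ nonAdj x y))
      ≡⟨ cong (nonEdgeCount +_) (sumFin-comm (λ x y → χ (y <ᶠ x ∧ nonAdj x y))) ⟩
    nonEdgeCount + sumFin (λ y → sumFin (λ x → χ (y <ᶠ x ∧ nonAdj x y)))
      ≡⟨ cong (nonEdgeCount +_)
           (sumFin-cong λ y → sumFin-cong λ x → cong (λ b → χ (y <ᶠ x ∧ b)) (nonAdj-sym x y)) ⟩
    nonEdgeCount + nonEdgeCount ∎
    where
    open ≡-Reasoning
    split : ∀ x y → χ (nonAdj x y) ≡ χ (x <ᶠ y ∧ nonAdj x y) + χ (y <ᶠ x ∧ nonAdj x y)
    split x y = by-cases (x ≟ᶠ y)
      where
      χ-split : ∀ c l′ {l} → l ≡ not l′ → χ c ≡ χ (l ∧ c) + χ (l′ ∧ c)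
      χ-split false false refl = refl
      χ-split false true  refl = refl
      χ-split true  false refl = refl
      χ-split true  true  refl = refl
      by-cases : Dec (x ≡ y) → χ (nonAdj x y) ≡ χ (x <ᶠ y ∧ nonAdj x y) + χ (y <ᶠ x ∧ nonAdj x y)
      by-cases (yes refl) rewrite ==-refl x | ∧-zeroʳ (x <ᶠ x) = refl
      by-cases (no x≢y)   = χ-split (nonAdj x y) (y <ᶠ x) (<ᶠ-connex x≢y)

module Partitioned {n v : ℕ} (v≥2 : 2 ≤ v) (G : Graph (Fin (n * v)))
  (f : Fin (n * v) → Fin n) (f-partition : IsCliquePartition n v G f)
  (f-unique : ∀ g → IsCliquePartition n v G g → SameDecomposition f g) where

  private
    V : Set
    V = Fin (n * v)

  block-size : ∀ p → count (λ x → f x == p) ≡ v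
  block-size = proj₁ f-partition

  block-clique : ∀ x y → f x ≡ f y → x ≢ y → adj G x y ≡ true
  block-clique = proj₂ f-partition

  adj-sym : ∀ x y → adj G x y ≡ adj G y x
  adj-sym = Graph.sym G

  open NonAdjacency G public

  separated : ∀ {p q x y} → p ≢ q → f x ≡ p → f y ≡ q → x ≢ y
  separated p≢q fx fy refl = p≢q (trans (sym fx) fy)

  block-inhabited : ∀ p → ∃ λ a → f a ≡ p
  block-inhabited p with sumFin-positive (λ x → χ (f x == p)) (subst (0 <_) (sym (block-size p)) (≤-trans z<s v≥2))
  ... | a , pos = a , ==-sound (χ-positive pos)

  another-in-block : ∀ p a → ∃ λ a′ → f a′ ≡ p × a′ ≢ a
  another-in-block p a with any? (λ x → (f x ≟ᶠ p) ×-dec ¬? (x ≟ᶠ a))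
  ... | yes hit  = hit
  ... | no  miss = ⊥-elim (≤⇒≯ block≤1 v≥2)
    where
    block⊆a : (λ x → f x == p) ⊆ (_== a)
    block⊆a x fx≡p with x ≟ᶠ a
    ... | yes _   = refl
    ... | no  x≢a = ⊥-elim (miss (x , ==-sound fx≡p , x≢a))

    block≤1 : v ≤ 1
    block≤1 = subst₂ _≤_ (block-size p) (count-point a) (count-mono block⊆a)

  relabelling-respects-blocks : ∀ g → (∀ s → count (λ x → g x == s) ≡ v) →
    (∀ x y → g x ≡ g y → x ≢ y → adj G x y ≡ true) → ∀ {a a′} → f a ≡ f a′ → g a ≡ g a′
  relabelling-respects-blocks g g-size g-clique {a} {a′} = proj₁ (f-unique g (g-size , g-clique) a a′)

  module Exchange {p q : Fin n} (p≢q : p ≢ q) (A X : V → Bool)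
    (A⊆p : ∀ x → A x ≡ true → f x ≡ p) (X⊆q : ∀ y → X y ≡ true → f y ≡ q)
    (|A|≡|X| : count A ≡ count X)
    (A-adj : ∀ x y → A x ≡ true → f y ≡ q → X y ≡ false → adj G x y ≡ true)
    (X-adj : ∀ x y → X y ≡ true → f x ≡ p → A x ≡ false → adj G x y ≡ true) where

    g : V → Fin n
    g x = if A x then q else if X x then p else f x

    data Kind (x : V) : Set where
      in-A  : A x ≡ true  → X x ≡ false → f x ≡ p → g x ≡ q → Kind x
      in-X  : A x ≡ false → X x ≡ true  → f x ≡ q → g x ≡ p → Kind x
      fixed : A x ≡ false → X x ≡ false → g x ≡ f x → Kind x

    g-A : ∀ {x} → A x ≡ true → g x ≡ q
    g-A Ax rewrite Ax = refl

    g-X : ∀ {x} → A x ≡ false → X x ≡ true → g x ≡ p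
    g-X Ax Xx rewrite Ax | Xx = refl

    g-fixed : ∀ {x} → A x ≡ false → X x ≡ false → g x ≡ f x
    g-fixed Ax Xx rewrite Ax | Xx = refl

    kind : ∀ x → Kind x
    kind x with A x in Ax | X x in Xx
    ... | true  | true  = ⊥-elim (p≢q (trans (sym (A⊆p x Ax)) (X⊆q x Xx)))
    ... | true  | false = in-A Ax Xx (A⊆p x Ax) (g-A Ax)
    ... | false | true  = in-X Ax Xx (X⊆q x Xx) (g-X Ax Xx)
    ... | false | false = fixed Ax Xx (g-fixed Ax Xx)

    g-clique : ∀ x y → g x ≡ g y → x ≢ y → adj G x y ≡ true
    g-clique x y gx≡gy x≢y with kind x | kind y
    ... | in-A _ _ fx _   | in-A _ _ fy _   = block-clique x y (trans fx (sym fy)) x≢y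
    ... | in-X _ _ fx _   | in-X _ _ fy _   = block-clique x y (trans fx (sym fy)) x≢y
    ... | fixed _ _ gx    | fixed _ _ gy    = block-clique x y (trans (sym gx) (trans gx≡gy gy)) x≢y
    ... | in-A _ _ _ gx   | in-X _ _ _ gy   = ⊥-elim (p≢q (trans (sym gy) (trans (sym gx≡gy) gx)))
    ... | in-X _ _ _ gx   | in-A _ _ _ gy   = ⊥-elim (p≢q (trans (sym gx) (trans gx≡gy gy)))
    ... | in-A Ax _ _ gx  | fixed _ Xy gy   = A-adj x y Ax (trans (sym gy) (trans (sym gx≡gy) gx)) Xy
    ... | fixed _ Xx gx   | in-A Ay _ _ gy  = trans (adj-sym x y) (A-adj y x Ay (trans (sym gx) (trans gx≡gy gy)) Xx)
    ... | in-X _ Xx _ gx  | fixed Ay _ gy   = trans (adj-sym x y) (X-adj y x Xx (trans (sym gy) (trans (sym gx≡gy) gx)) Ay)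
    ... | fixed Ax _ gx   | in-X _ Xy _ gy  = X-adj x y Xy (trans (sym gx) (trans gx≡gy gy)) Ax

    gains-X : ∀ x → χ (g x == p) + χ (A x) ≡ χ (f x == p) + χ (X x)
    gains-X x with kind x
    ... | in-A Ax Xx fx gx rewrite Ax | Xx | fx | gx | ==-false (≢-sym p≢q) | ==-refl p = refl
    ... | in-X Ax Xx fx gx rewrite Ax | Xx | fx | gx | ==-false (≢-sym p≢q) | ==-refl p = refl
    ... | fixed Ax Xx gx   rewrite Ax | Xx | gx = refl

    gains-A : ∀ x → χ (g x == q) + χ (X x) ≡ χ (f x == q) + χ (A x)
    gains-A x with kind x
    ... | in-A Ax Xx fx gx rewrite Ax | Xx | fx | gx | ==-false p≢q | ==-refl q = refl
    ... | in-X Ax Xx fx gx rewrite Ax | Xx | fx | gx | ==-false p≢q | ==-refl q = refl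
    ... | fixed Ax Xx gx   rewrite Ax | Xx | gx = refl

    unchanged : ∀ {s} → s ≢ p → s ≢ q → ∀ x → χ (g x == s) ≡ χ (f x == s)
    unchanged s≢p s≢q x with kind x
    ... | in-A _ _ fx gx rewrite fx | gx | ==-false (≢-sym s≢q) | ==-false (≢-sym s≢p) = refl
    ... | in-X _ _ fx gx rewrite fx | gx | ==-false (≢-sym s≢q) | ==-false (≢-sym s≢p) = refl
    ... | fixed _ _ gx   rewrite gx = refl

    g-size : ∀ s → count (λ x → g x == s) ≡ v
    g-size s with s ≟ᶠ p | s ≟ᶠ q
    ... | yes refl | _        = trans (sumFin-balance _ (χ ∘ A) _ (χ ∘ X) gains-X |A|≡|X|) (block-size p)
    ... | no _     | yes refl = trans (sumFin-balance _ (χ ∘ X) _ (χ ∘ A) gains-A (sym |A|≡|X|)) (block-size q)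
    ... | no s≢p   | no s≢q   = trans (sumFin-cong (unchanged s≢p s≢q)) (block-size s)

    impossible : ∀ {a a′} → A a ≡ true → f a′ ≡ p → A a′ ≡ false → ⊥
    impossible {a} {a′} Aa fa′ Aa′ = p≢q (begin
      p      ≡⟨ trans (g-fixed Aa′ X-a′) fa′ ⟨
      g a′   ≡⟨ relabelling-respects-blocks g g-size g-clique (trans fa′ (sym (A⊆p a Aa))) ⟩
      g a    ≡⟨ g-A Aa ⟩
      q      ∎)
      where
      open ≡-Reasoning
      X-a′ : X a′ ≡ false
      X-a′ with X a′ in Xa′
      ... | true  = ⊥-elim (p≢q (trans (sym fa′) (X⊆q a′ Xa′)))
      ... | false = refl

  no-transposition : ∀ {p q a b} → p ≢ q → f a ≡ p → f b ≡ q →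
    (∀ y → f y ≡ q → y ≢ b → adj G a y ≡ true) →
    (∀ x → f x ≡ p → x ≢ a → adj G x b ≡ true) → ⊥
  no-transposition {p} {q} {a} {b} p≢q fa fb a-adj b-adj =
    Exchange.impossible p≢q (_== a) (_== b)
      (λ x x≡a → trans (cong f (==-sound x≡a)) fa) (λ y y≡b → trans (cong f (==-sound y≡b)) fb)
      (trans (count-point a) (sym (count-point b)))
      (λ x y x≡a fy y≢b →
        subst (λ u → adj G u y ≡ true) (sym (==-sound x≡a)) (a-adj y fy (==-sound-false y≢b)))
      (λ x y y≡b fx x≢a →
        subst (λ u → adj G x u ≡ true) (sym (==-sound y≡b)) (b-adj x fx (==-sound-false x≢a)))
      (==-refl a) (proj₁ (proj₂ (another-in-block p a))) (==-false (proj₂ (proj₂ (another-in-block p a))))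

  module Rotation {p q r : Fin n} (p≢q : p ≢ q) (q≢r : q ≢ r) (r≢p : r ≢ p) {a b c : V}
    (fa : f a ≡ p) (fb : f b ≡ q) (fc : f c ≡ r)
    (a-adj : ∀ y → f y ≡ q → y ≢ b → adj G a y ≡ true)
    (b-adj : ∀ z → f z ≡ r → z ≢ c → adj G b z ≡ true)
    (c-adj : ∀ x → f x ≡ p → x ≢ a → adj G c x ≡ true) where

    g : V → Fin n
    g x = if x == a then q else if x == b then r else if x == c then p else f x

    a≢b : a ≢ b
    a≢b = separated p≢q fa fb
    b≢c : b ≢ c
    b≢c = separated q≢r fb fc
    c≢a : c ≢ a
    c≢a = separated r≢p fc fa

    g-a : g a ≡ q
    g-a rewrite ==-refl a = refl

    g-b : g b ≡ r
    g-b rewrite ==-false (≢-sym a≢b) | ==-refl b = refl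

    g-c : g c ≡ p
    g-c rewrite ==-false c≢a | ==-false (≢-sym b≢c) | ==-refl c = refl

    g-fixed : ∀ {x} → x ≢ a → x ≢ b → x ≢ c → g x ≡ f x
    g-fixed x≢a x≢b x≢c rewrite ==-false x≢a | ==-false x≢b | ==-false x≢c = refl

    data Kind (x : V) : Set where
      at-a  : x ≡ a → Kind x
      at-b  : x ≡ b → Kind x
      at-c  : x ≡ c → Kind x
      fixed : x ≢ a → x ≢ b → x ≢ c → Kind x

    kind : ∀ x → Kind x
    kind x with x ≟ᶠ a | x ≟ᶠ b | x ≟ᶠ c
    ... | yes x≡a | _       | _       = at-a x≡a
    ... | no _    | yes x≡b | _       = at-b x≡b
    ... | no _    | no _    | yes x≡c = at-c x≡c
    ... | no x≢a  | no x≢b  | no x≢c  = fixed x≢a x≢b x≢c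

    g-clique : ∀ x y → g x ≡ g y → x ≢ y → adj G x y ≡ true
    g-clique x y gx≡gy x≢y with kind x | kind y
    ... | at-a refl | at-a refl = ⊥-elim (x≢y refl)
    ... | at-b refl | at-b refl = ⊥-elim (x≢y refl)
    ... | at-c refl | at-c refl = ⊥-elim (x≢y refl)
    ... | at-a refl | at-b refl = ⊥-elim (q≢r (trans (sym g-a) (trans gx≡gy g-b)))
    ... | at-b refl | at-a refl = ⊥-elim (q≢r (trans (sym g-a) (trans (sym gx≡gy) g-b)))
    ... | at-b refl | at-c refl = ⊥-elim (r≢p (trans (sym g-b) (trans gx≡gy g-c)))
    ... | at-c refl | at-b refl = ⊥-elim (r≢p (trans (sym g-b) (trans (sym gx≡gy) g-c)))
    ... | at-c refl | at-a refl = ⊥-elim (p≢q (trans (sym g-c) (trans gx≡gy g-a)))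
    ... | at-a refl | at-c refl = ⊥-elim (p≢q (trans (sym g-c) (trans (sym gx≡gy) g-a)))
    ... | at-a refl | fixed y≢a y≢b y≢c = a-adj y (trans (sym (g-fixed y≢a y≢b y≢c)) (trans (sym gx≡gy) g-a)) y≢b
    ... | at-b refl | fixed y≢a y≢b y≢c = b-adj y (trans (sym (g-fixed y≢a y≢b y≢c)) (trans (sym gx≡gy) g-b)) y≢c
    ... | at-c refl | fixed y≢a y≢b y≢c = c-adj y (trans (sym (g-fixed y≢a y≢b y≢c)) (trans (sym gx≡gy) g-c)) y≢a
    ... | fixed x≢a x≢b x≢c | at-a refl =
      trans (adj-sym x a) (a-adj x (trans (sym (g-fixed x≢a x≢b x≢c)) (trans gx≡gy g-a)) x≢b)
    ... | fixed x≢a x≢b x≢c | at-b refl =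
      trans (adj-sym x b) (b-adj x (trans (sym (g-fixed x≢a x≢b x≢c)) (trans gx≡gy g-b)) x≢c)
    ... | fixed x≢a x≢b x≢c | at-c refl =
      trans (adj-sym x c) (c-adj x (trans (sym (g-fixed x≢a x≢b x≢c)) (trans gx≡gy g-c)) x≢a)
    ... | fixed x≢a x≢b x≢c | fixed y≢a y≢b y≢c = block-clique x y
      (trans (sym (g-fixed x≢a x≢b x≢c)) (trans gx≡gy (g-fixed y≢a y≢b y≢c))) x≢y

    balanced : ∀ s {leaves enters} →
      (∀ x → χ (g x == s) + χ (x == leaves) ≡ χ (f x == s) + χ (x == enters)) →
      count (λ x → g x == s) ≡ v
    balanced s {leaves} {enters} pointwise = trans
      (sumFin-balance _ (χ ∘ (_== leaves)) _ (χ ∘ (_== enters)) pointwise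
        (trans (count-point leaves) (sym (count-point enters))))
      (block-size s)

    p-balance : ∀ x → χ (g x == p) + χ (x == a) ≡ χ (f x == p) + χ (x == c)
    p-balance x with kind x
    ... | at-a refl rewrite g-a | fa | ==-refl a | ==-false (≢-sym c≢a) | ==-false (≢-sym p≢q)
                          | ==-refl p = refl
    ... | at-b refl rewrite g-b | fb | ==-false (≢-sym a≢b) | ==-false b≢c | ==-false r≢p
                          | ==-false (≢-sym p≢q) = refl
    ... | at-c refl rewrite g-c | fc | ==-false c≢a | ==-refl c | ==-refl p | ==-false r≢p = refl
    ... | fixed x≢a x≢b x≢c rewrite g-fixed x≢a x≢b x≢c | ==-false x≢a | ==-false x≢c = refl

    q-balance : ∀ x → χ (g x == q) + χ (x == b) ≡ χ (f x == q) + χ (x == a)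
    q-balance x with kind x
    ... | at-a refl rewrite g-a | fa | ==-refl a | ==-false a≢b | ==-refl q | ==-false p≢q = refl
    ... | at-b refl rewrite g-b | fb | ==-refl b | ==-false (≢-sym a≢b) | ==-false (≢-sym q≢r)
                          | ==-refl q = refl
    ... | at-c refl rewrite g-c | fc | ==-false c≢a | ==-false (≢-sym b≢c) | ==-false p≢q
                          | ==-false (≢-sym q≢r) = refl
    ... | fixed x≢a x≢b x≢c rewrite g-fixed x≢a x≢b x≢c | ==-false x≢a | ==-false x≢b = refl

    r-balance : ∀ x → χ (g x == r) + χ (x == c) ≡ χ (f x == r) + χ (x == b)
    r-balance x with kind x
    ... | at-a refl rewrite g-a | fa | ==-false (≢-sym c≢a) | ==-false a≢b | ==-false q≢r
                          | ==-false (≢-sym r≢p) = refl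
    ... | at-b refl rewrite g-b | fb | ==-false b≢c | ==-refl b | ==-refl r | ==-false q≢r = refl
    ... | at-c refl rewrite g-c | fc | ==-refl c | ==-false (≢-sym b≢c) | ==-false (≢-sym r≢p)
                          | ==-refl r = refl
    ... | fixed x≢a x≢b x≢c rewrite g-fixed x≢a x≢b x≢c | ==-false x≢b | ==-false x≢c = refl

    unchanged : ∀ {s} → s ≢ p → s ≢ q → s ≢ r → ∀ x → χ (g x == s) ≡ χ (f x == s)
    unchanged s≢p s≢q s≢r x with kind x
    ... | at-a refl rewrite g-a | fa | ==-false (≢-sym s≢q) | ==-false (≢-sym s≢p) = refl
    ... | at-b refl rewrite g-b | fb | ==-false (≢-sym s≢r) | ==-false (≢-sym s≢q) = refl
    ... | at-c refl rewrite g-c | fc | ==-false (≢-sym s≢p) | ==-false (≢-sym s≢r) = refl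
    ... | fixed x≢a x≢b x≢c rewrite g-fixed x≢a x≢b x≢c = refl

    g-size : ∀ s → count (λ x → g x == s) ≡ v
    g-size s with s ≟ᶠ p | s ≟ᶠ q | s ≟ᶠ r
    ... | yes refl | _        | _        = balanced p p-balance
    ... | no _     | yes refl | _        = balanced q q-balance
    ... | no _     | no _     | yes refl = balanced r r-balance
    ... | no s≢p   | no s≢q   | no s≢r   = trans (sumFin-cong (unchanged s≢p s≢q s≢r)) (block-size s)

    impossible : ⊥
    impossible with another-in-block p a
    ... | a′ , fa′ , a′≢a = p≢q (trans (sym ga′) (trans (sym same-label) g-a))
      where
      ga′ : g a′ ≡ p
      ga′ = trans (g-fixed a′≢a (separated p≢q fa′ fb) (separated (≢-sym r≢p) fa′ fc)) fa′
      same-label : g a ≡ g a′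
      same-label = relabelling-respects-blocks g g-size g-clique (trans fa (sym fa′))

  deficit : Fin n → V → ℕ
  deficit q x = count (λ y → f y == q ∧ nonAdj x y)

  nonEdges : Fin n → Fin n → ℕ
  nonEdges p q = sumFin (λ x → sumFin (λ y → χ (f x == p ∧ (f y == q ∧ nonAdj x y))))

  nonEdges-byRow : ∀ p q → nonEdges p q ≡ sumFin (λ x → if f x == p then deficit q x else 0)
  nonEdges-byRow p q = sumFin-cong λ x → sumFin-χ-∧ (f x == p) (λ y → f y == q ∧ nonAdj x y)

  nonEdges-sym : ∀ p q → nonEdges q p ≡ nonEdges p q
  nonEdges-sym p q = trans (sumFin-comm (λ x y → χ (f x == q ∧ (f y == p ∧ nonAdj x y))))
    (sumFin-cong λ y → sumFin-cong λ x → cong χ (swap (f x == q) (f y == p) (nonAdj-sym x y)))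
    where
    swap : ∀ a b {c c′} → c ≡ c′ → a ∧ (b ∧ c) ≡ b ∧ (a ∧ c′)
    swap true  true  eq = eq
    swap true  false _  = refl
    swap false true  _  = refl
    swap false false _  = refl

  nonEdges-total : sumFin (λ p → sumFin (nonEdges p)) ≡ nonAdjacentPairs
  nonEdges-total = begin
    sumFin (λ p → sumFin (λ q → sumFin (λ x → sumFin (λ y → F p q x y))))
      ≡⟨ sumFin-cong (λ p → sumFin-comm (λ q x → sumFin (λ y → F p q x y))) ⟩
    sumFin (λ p → sumFin (λ x → sumFin (λ q → sumFin (λ y → F p q x y))))
      ≡⟨ sumFin-comm (λ p x → sumFin (λ q → sumFin (λ y → F p q x y))) ⟩
    sumFin (λ x → sumFin (λ p → sumFin (λ q → sumFin (λ y → F p q x y))))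
      ≡⟨ sumFin-cong (λ x → sumFin-cong (λ p → sumFin-comm (λ q y → F p q x y))) ⟩
    sumFin (λ x → sumFin (λ p → sumFin (λ y → sumFin (λ q → F p q x y))))
      ≡⟨ sumFin-cong (λ x → sumFin-comm (λ p y → sumFin (λ q → F p q x y))) ⟩
    sumFin (λ x → sumFin (λ y → sumFin (λ p → sumFin (λ q → F p q x y))))
      ≡⟨ sumFin-cong (λ x → sumFin-cong (λ y → labels-once x y)) ⟩
    nonAdjacentPairs ∎
    where
    open ≡-Reasoning
    F : Fin n → Fin n → Fin (n * v) → Fin (n * v) → ℕ
    F p q x y = χ (f x == p ∧ (f y == q ∧ nonAdj x y))
    one-label : ∀ (a : Fin n) c → sumFin (λ p → χ (a == p ∧ c)) ≡ χ c
    one-label a true  = trans (sumFin-cong λ p → cong χ (trans (∧-identityʳ (a == p)) (==-sym a p))) (count-point a)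
    one-label a false = sumFin-zero λ p → cong χ (∧-zeroʳ (a == p))
    if-χ : ∀ b c → (if b then χ c else 0) ≡ χ (b ∧ c)
    if-χ true  c = refl
    if-χ false c = refl
    labels-once : ∀ x y → sumFin (λ p → sumFin (λ q → F p q x y)) ≡ χ (nonAdj x y)
    labels-once x y = trans (sumFin-cong λ p → begin
        sumFin (λ q → F p q x y)
          ≡⟨ sumFin-χ-∧ (f x == p) (λ q → f y == q ∧ nonAdj x y) ⟩
        (if f x == p then count (λ q → f y == q ∧ nonAdj x y) else 0)
          ≡⟨ cong (λ k → if f x == p then k else 0) (one-label (f y) (nonAdj x y)) ⟩
        (if f x == p then χ (nonAdj x y) else 0)
          ≡⟨ if-χ (f x == p) (nonAdj x y) ⟩
        χ (f x == p ∧ nonAdj x y) ∎)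
      (one-label (f x) (nonAdj x y))

  deficit-zero⇒adjacent : ∀ {q x y} → deficit q x ≡ 0 → f y ≡ q → x ≢ y → adj G x y ≡ true
  deficit-zero⇒adjacent {q} {x} {y} deficit≡0 fy x≢y = ¬nonAdj⇒adjacent x≢y
    (χ≡0 (trans (cong (λ b → χ (b ∧ nonAdj x y)) (sym (==-true fy))) (sumFin≡0⇒≡0 _ deficit≡0 y)))
    where
    χ≡0 : ∀ {b} → χ b ≡ 0 → b ≡ false
    χ≡0 {false} _ = refl

  deficit-free-vertex : ∀ p q → nonEdges p q < v → ∃ λ a → f a ≡ p × deficit q a ≡ 0
  deficit-free-vertex p q nonEdges<v with any? (λ x → (f x ≟ᶠ p) ×-dec (deficit q x ≟ 0))
  ... | yes hit  = hit
  ... | no  miss = ⊥-elim (<⇒≱ nonEdges<v (begin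
    v                                                          ≡⟨ block-size p ⟨
    count (λ x → f x == p)                                     ≤⟨ sumFin-mono pointwise ⟩
    sumFin (λ x → if f x == p then deficit q x else 0)          ≡⟨ nonEdges-byRow p q ⟨
    nonEdges p q                                               ∎))
    where
    open ≤-Reasoning
    pointwise : ∀ x → χ (f x == p) ≤ (if f x == p then deficit q x else 0)
    pointwise x with f x == p in fx
    ... | true  = n≢0⇒n>0 λ deficit≡0 → miss (x , ==-sound fx , deficit≡0)
    ... | false = z≤n

  not-both-deficit-free : ∀ {p q a b} → p ≢ q →
    f a ≡ p → deficit q a ≡ 0 → f b ≡ q → deficit p b ≡ 0 → ⊥
  not-both-deficit-free {p} {q} {a} {b} p≢q fa a-free fb b-free = no-transposition p≢q fa fb
    (λ y fy _ → deficit-zero⇒adjacent a-free fy (separated p≢q fa fy))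
    (λ x fx _ → trans (adj-sym x b) (deficit-zero⇒adjacent b-free fx (separated (≢-sym p≢q) fb fx)))

  v≤nonEdges : ∀ {p q} → p ≢ q → v ≤ nonEdges p q
  v≤nonEdges {p} {q} p≢q with v ≤? nonEdges p q
  ... | yes v≤ = v≤
  ... | no  v≰ with deficit-free-vertex p q (≰⇒> v≰)
                  | deficit-free-vertex q p (subst (_< v) (sym (nonEdges-sym p q)) (≰⇒> v≰))
  ...   | a , fa , a-free | b , fb , b-free = ⊥-elim (not-both-deficit-free p≢q fa a-free fb b-free)

  -- In Γ′ n v, the vertex (i , 0) is a hub of row i towards every row k > i.
  record Hub (p q : Fin n) (c : V) : Set where
    field
      in-block    : f c ≡ p
      nonadjacent : ∀ {y} → f y ≡ q → adj G c y ≡ false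
      sole        : ∀ {x y} → f x ≡ p → f y ≡ q → adj G x y ≡ false → x ≡ c

  module Covering {p q : Fin n} (p≢q : p ≢ q) (nonEdges≡v : nonEdges p q ≡ v)
    (covered : ∀ x → f x ≡ p → 1 ≤ deficit q x) where

    deficit≡1 : ∀ {x} → f x ≡ p → deficit q x ≡ 1
    deficit≡1 {x} fx = begin
      deficit q x                             ≡⟨ cong (λ b → if b then deficit q x else 0) (==-true fx) ⟨
      (if f x == p then deficit q x else 0)   ≡⟨ sumFin-tight {g = λ x → χ (f x == p)} pointwise tight x ⟩
      χ (f x == p)                            ≡⟨ cong χ (==-true fx) ⟩
      1                                       ∎
      where
      open ≡-Reasoning
      pointwise : ∀ x → χ (f x == p) ≤ (if f x == p then deficit q x else 0)
      pointwise x with f x == p in fx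
      ... | true  = covered x (==-sound fx)
      ... | false = z≤n
      tight : sumFin (λ x → if f x == p then deficit q x else 0) ≤ count (λ x → f x == p)
      tight = ≤-reflexive (trans (sym (nonEdges-byRow p q)) (trans nonEdges≡v (sym (block-size p))))

    unique-nonneighbour : ∀ {x y y′} → f x ≡ p → f y ≡ q → f y′ ≡ q →
      adj G x y ≡ false → adj G x y′ ≡ false → y ≡ y′
    unique-nonneighbour {x} {y} {y′} fx fy fy′ x≁y x≁y′ with y ≟ᶠ y′
    ... | yes y≡y′ = y≡y′
    ... | no  y≢y′ = ⊥-elim (≤⇒≯ (≤-reflexive (deficit≡1 fx))
                               (count-two y≢y′ (nonneighbour fy x≁y) (nonneighbour fy′ x≁y′)))
      where
      nonneighbour : ∀ {z} → f z ≡ q → adj G x z ≡ false → f z == q ∧ nonAdj x z ≡ true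
      nonneighbour {z} fz x≁z = cong₂ _∧_ (==-true fz)
        (nonadjacent⇒nonAdj (separated p≢q fx fz) x≁z)

    module _ {a₀ c₀ : V} (fa₀ : f a₀ ≡ p) (fc₀ : f c₀ ≡ q) (a₀≁c₀ : adj G a₀ c₀ ≡ false) where

      -- The neighbours A ⊆ p of c₀ have all their non-neighbours in q ∖ {c₀}; these fit
      -- into a set X ⊆ q ∖ {c₀} with |X| = |A|, and exchanging A and X is a second partition.
      A : V → Bool
      A x = f x == p ∧ adj G x c₀

      hits : V → ℕ
      hits y = count (λ x → A x ∧ nonAdj x y)

      Y : V → Bool
      Y y = f y == q ∧ (0 <ᵇ hits y)

      U : V → Bool
      U y = f y == q ∧ not (y == c₀)

      A-a₀ : A a₀ ≡ false
      A-a₀ = trans (cong (f a₀ == p ∧_) a₀≁c₀) (∧-zeroʳ _)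

      A⊆p : ∀ x → A x ≡ true → f x ≡ p
      A⊆p x Ax = ==-sound (∧-conicalˡ (f x == p) _ Ax)

      hit⇒Y : ∀ {x y} → A x ≡ true → f y ≡ q → adj G x y ≡ false → Y y ≡ true
      hit⇒Y {x} {y} Ax fy x≁y = cong₂ _∧_ (==-true fy) (Equivalence.to T-≡ (<⇒<ᵇ (≤-trans
        (≤-reflexive (cong χ (sym (cong₂ _∧_ Ax (nonadjacent⇒nonAdj x≢y x≁y)))))
        (term≤sumFin (λ x → χ (A x ∧ nonAdj x y)) x))))
        where
        x≢y : x ≢ y
        x≢y = separated p≢q (A⊆p x Ax) fy

      Y⊆U : Y ⊆ U
      Y⊆U y Yy with sumFin-positive (λ x → χ (A x ∧ nonAdj x y))
                      (<ᵇ⇒< 0 (hits y) (Equivalence.from T-≡ (∧-conicalʳ (f y == q) _ Yy)))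
      ... | x , pos = cong₂ _∧_ (∧-conicalˡ (f y == q) _ Yy) (cong not (==-false y≢c₀))
        where
        x-hits-y : A x ∧ nonAdj x y ≡ true
        x-hits-y = χ-positive pos
        y≢c₀ : y ≢ c₀
        y≢c₀ y≡c₀ = true≢false (trans (sym (∧-conicalʳ (f x == p) _ (∧-conicalˡ (A x) _ x-hits-y)))
          (trans (cong (adj G x) (sym y≡c₀)) (nonAdj⇒nonadjacent (∧-conicalʳ (A x) _ x-hits-y))))

      |Y|≤|A| : count Y ≤ count A
      |Y|≤|A| = begin
        count Y                                                      ≤⟨ sumFin-mono Y≤hits ⟩
        sumFin (λ y → if f y == q then hits y else 0)                ≡⟨ sumFin-cong hits-as-sum ⟩
        sumFin (λ y → sumFin (λ x → χ (A x ∧ (f y == q ∧ nonAdj x y))))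
          ≡⟨ sumFin-comm (λ x y → χ (A x ∧ (f y == q ∧ nonAdj x y))) ⟨
        sumFin (λ x → sumFin (λ y → χ (A x ∧ (f y == q ∧ nonAdj x y))))
          ≡⟨ sumFin-cong (λ x → sumFin-χ-∧ (A x) (λ y → f y == q ∧ nonAdj x y)) ⟩
        sumFin (λ x → if A x then deficit q x else 0)                ≡⟨ sumFin-cong deficit-on-A ⟩
        count A                                                      ∎
        where
        open ≤-Reasoning
        χ-<ᵇ : ∀ m → χ (0 <ᵇ m) ≤ m
        χ-<ᵇ zero    = z≤n
        χ-<ᵇ (suc m) = s≤s z≤n
        Y≤hits : ∀ y → χ (Y y) ≤ (if f y == q then hits y else 0)
        Y≤hits y with f y == q
        ... | true  = χ-<ᵇ (hits y)
        ... | false = z≤n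
        hits-as-sum : ∀ y → (if f y == q then hits y else 0) ≡ sumFin (λ x → χ (A x ∧ (f y == q ∧ nonAdj x y)))
        hits-as-sum y with f y == q
        ... | true  = refl
        ... | false = sym (sumFin-zero λ x → cong χ (∧-zeroʳ (A x)))
        deficit-on-A : ∀ x → (if A x then deficit q x else 0) ≡ χ (A x)
        deficit-on-A x with A x in Ax
        ... | true  = deficit≡1 (A⊆p x Ax)
        ... | false = refl

      |A|≤|U| : count A ≤ count U
      |A|≤|U| = ≤-pred (begin
        suc (count A)              ≤⟨ count-< (λ x Ax → ∧-conicalˡ (f x == p) _ Ax) (==-true fa₀) A-a₀ ⟩
        count (λ x → f x == p)     ≡⟨ trans (block-size p) (sym (block-size q)) ⟩
        count (λ y → f y == q)     ≡⟨ count-remove {Q = λ y → f y == q} {c₀} (==-true fc₀) ⟨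
        count U + 1                ≡⟨ +-comm (count U) 1 ⟩
        suc (count U)              ∎)
        where open ≤-Reasoning

      between : ∃ λ X → Y ⊆ X × X ⊆ U × count X ≡ count A
      between = exists-between Y U Y⊆U |Y|≤|A| |A|≤|U|

      X : V → Bool
      X = proj₁ between

      X⊆U : X ⊆ U
      X⊆U = proj₁ (proj₂ (proj₂ between))

      X⊆q : ∀ y → X y ≡ true → f y ≡ q
      X⊆q y Xy = ==-sound (∧-conicalˡ (f y == q) _ (X⊆U y Xy))

      |X|≡|A| : count X ≡ count A
      |X|≡|A| = proj₂ (proj₂ (proj₂ between))

      A-adj : ∀ x y → A x ≡ true → f y ≡ q → X y ≡ false → adj G x y ≡ true
      A-adj x y Ax fy Xy with adj G x y in xy
      ... | true  = refl
      ... | false = ⊥-elim (true≢false (trans (sym (proj₁ (proj₂ between) y (hit⇒Y Ax fy xy))) Xy))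

      X-adj : ∀ x y → X y ≡ true → f x ≡ p → A x ≡ false → adj G x y ≡ true
      X-adj x y Xy fx Ax with adj G x y in xy
      ... | true  = refl
      ... | false = ⊥-elim (true≢false
                      (trans (sym (∧-conicalʳ (f y == q) _ (X⊆U y Xy))) (cong not (==-true y≡c₀))))
        where
        x≁c₀ : adj G x c₀ ≡ false
        x≁c₀ = trans (sym (cong (_∧ adj G x c₀) (==-true fx))) Ax
        y≡c₀ : y ≡ c₀
        y≡c₀ = unique-nonneighbour fx (X⊆q y Xy) fc₀ xy x≁c₀

      no-neighbour-of-c₀ : ∀ {x₁} → f x₁ ≡ p → adj G x₁ c₀ ≡ true → ⊥
      no-neighbour-of-c₀ {x₁} fx₁ x₁∼c₀ = Exchange.impossible p≢q A X A⊆p X⊆q (sym |X|≡|A|) A-adj X-adj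
        (cong₂ _∧_ (==-true fx₁) x₁∼c₀) fa₀ A-a₀

      nonadjacent-to-c₀ : ∀ {x} → f x ≡ p → adj G x c₀ ≡ false
      nonadjacent-to-c₀ {x} fx with adj G x c₀ in x∼c₀
      ... | true  = ⊥-elim (no-neighbour-of-c₀ fx x∼c₀)
      ... | false = refl

      c₀-hub : Hub q p c₀
      c₀-hub = record
        { in-block    = fc₀
        ; nonadjacent = λ {y} fy → trans (adj-sym c₀ y) (nonadjacent-to-c₀ fy)
        ; sole        = λ {x} {y} fx fy x≁y →
            unique-nonneighbour fy fx fc₀ (trans (adj-sym y x) x≁y) (nonadjacent-to-c₀ fy)
        }

    hub : ∃ (Hub q p)
    hub with block-inhabited p
    ... | a₀ , fa₀ with sumFin-positive _ (≤-reflexive (sym (deficit≡1 fa₀)))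
    ...   | c₀ , pos = c₀ , c₀-hub fa₀ (==-sound (∧-conicalˡ (f c₀ == q) _ nonneighbour))
                                        (nonAdj⇒nonadjacent (∧-conicalʳ (f c₀ == q) _ nonneighbour))
      where
      nonneighbour : f c₀ == q ∧ nonAdj a₀ c₀ ≡ true
      nonneighbour = χ-positive pos

  module _ {p q c} (H : Hub p q c) where
    open Hub H

    hub-adjacent : ∀ {x y} → f x ≡ p → f y ≡ q → x ≢ c → adj G x y ≡ true
    hub-adjacent {x} {y} fx fy x≢c with adj G x y in xy
    ... | true  = refl
    ... | false = ⊥-elim (x≢c (sole fx fy xy))

    hub-blocks-distinct : p ≢ q
    hub-blocks-distinct refl with another-in-block p c
    ... | y , fy , y≢c =
      true≢false (trans (sym (block-clique c y (trans in-block (sym fy)) (≢-sym y≢c))) (nonadjacent fy))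

    hub-unique : ∀ {c′} → Hub p q c′ → c ≡ c′
    hub-unique H′ with block-inhabited q
    ... | y , fy = Hub.sole H′ in-block fy (nonadjacent fy)

    hub-asym : ∀ {c′} → Hub q p c′ → ⊥
    hub-asym {c′} H′ with another-in-block q c′
    ... | y , fy , y≢c′ = y≢c′ (Hub.sole H′ fy in-block (trans (adj-sym y c) (nonadjacent fy)))

  no-hub-cycle : ∀ {p q r a b c} → Hub p q a → Hub q r b → Hub r p c → ⊥
  no-hub-cycle {p} {q} {r} {a} {b} {c} Ha Hb Hc =
    Rotation.impossible
      (≢-sym (hub-blocks-distinct Hc)) (≢-sym (hub-blocks-distinct Hb)) (≢-sym (hub-blocks-distinct Ha))
      (Hub.in-block Ha) (Hub.in-block Hc) (Hub.in-block Hb)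
      (λ y fy y≢c → trans (adj-sym a y) (hub-adjacent Hc fy (Hub.in-block Ha) y≢c))
      (λ z fz z≢b → trans (adj-sym c z) (hub-adjacent Hb fz (Hub.in-block Hc) z≢b))
      (λ x fx x≢a → trans (adj-sym b x) (hub-adjacent Ha fx (Hub.in-block Hb) x≢a))

module Maximal {n v : ℕ} (v≥2 : 2 ≤ v) (G : Graph (Fin (n * v)))
  (f : Fin (n * v) → Fin n) (f-partition : IsCliquePartition n v G f)
  (f-unique : ∀ g → IsCliquePartition n v G g → SameDecomposition f g)
  (edges : edgeCount G ≡ (n * v) C 2 ∸ n * (n ∸ 1) * v / 2) where

  open Partitioned v≥2 G f f-partition f-unique

  nonAdjacentPairs≤ : nonAdjacentPairs ≤ n * (n ∸ 1) * v
  nonAdjacentPairs≤ = begin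
    nonAdjacentPairs             ≡⟨ nonAdjacentPairs≡2*nonEdgeCount ⟩
    nonEdgeCount + nonEdgeCount  ≤⟨ +-mono-≤ nonEdgeCount≤ nonEdgeCount≤ ⟩
    K / 2 + K / 2                ≡⟨ trans (cong (K / 2 +_) (sym (+-identityʳ (K / 2)))) (*-comm 2 (K / 2)) ⟩
    K / 2 * 2                    ≤⟨ m/n*n≤m K 2 ⟩
    K                            ∎
    where
    open ≤-Reasoning
    K : ℕ
    K = n * (n ∸ 1) * v
    nonEdgeCount≤ : nonEdgeCount ≤ K / 2
    nonEdgeCount≤ = begin
      nonEdgeCount                                 ≡⟨ m+n∸m≡n (edgeCount G) nonEdgeCount ⟨
      edgeCount G + nonEdgeCount ∸ edgeCount G     ≡⟨ cong₂ _∸_ edgeCount+nonEdgeCount edges ⟩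
      (n * v) C 2 ∸ ((n * v) C 2 ∸ K / 2)          ≤⟨ m∸[m∸n]≤n ((n * v) C 2) (K / 2) ⟩
      K / 2                                        ∎

  nonEdges≡v : ∀ {p q} → p ≢ q → nonEdges p q ≡ v
  nonEdges≡v {p} {q} p≢q = begin
    nonEdges p q     ≡⟨ sumFin-tight (lower≤nonEdges p) (≤-reflexive (row-tight p)) q ⟩
    lower p q        ≡⟨ cong (λ b → χ (not b) * v) (==-false p≢q) ⟩
    1 * v            ≡⟨ *-identityˡ v ⟩
    v                ∎
    where
    open ≡-Reasoning
    lower : Fin n → Fin n → ℕ
    lower p q = χ (not (p == q)) * v
    lower≤nonEdges : ∀ p q → lower p q ≤ nonEdges p q
    lower≤nonEdges p q with p ≟ᶠ q
    ... | yes refl = z≤n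
    ... | no  p≢q  = ≤-trans (≤-reflexive (*-identityˡ v)) (v≤nonEdges p≢q)
    total-lower : sumFin (λ p → sumFin (lower p)) ≡ n * (n ∸ 1) * v
    total-lower = begin
      sumFin (λ p → sumFin (lower p))
        ≡⟨ sumFin-cong (λ p → trans (sumFin-*ʳ (λ q → χ (not (p == q))) v) (cong (_* v) (count-others {n} p))) ⟩
      sumFin {n} (λ _ → (n ∸ 1) * v)    ≡⟨ sumFin-const n ((n ∸ 1) * v) ⟩
      n * ((n ∸ 1) * v)                 ≡⟨ *-assoc n (n ∸ 1) v ⟨
      n * (n ∸ 1) * v                   ∎
    row-tight : ∀ p → sumFin (nonEdges p) ≡ sumFin (lower p)
    row-tight = sumFin-tight (λ p → sumFin-mono (lower≤nonEdges p))
      (≤-trans (≤-reflexive nonEdges-total) (≤-trans nonAdjacentPairs≤ (≤-reflexive (sym total-lower))))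

  Arc : Fin n → Fin n → Set
  Arc p q = ∃ (Hub p q)

  arc-connex : ∀ {p q} → p ≢ q → Arc p q ⊎ Arc q p
  arc-connex {p} {q} p≢q with any? (λ x → (f x ≟ᶠ p) ×-dec (deficit q x ≟ 0))
                            | any? (λ y → (f y ≟ᶠ q) ×-dec (deficit p y ≟ 0))
  ... | yes (a , fa , a-free) | yes (b , fb , b-free) = ⊥-elim (not-both-deficit-free p≢q fa a-free fb b-free)
  ... | no none | _       =
    inj₂ (Covering.hub p≢q (nonEdges≡v p≢q) (λ x fx → n≢0⇒n>0 λ e → none (x , fx , e)))
  ... | yes _   | no none =
    inj₁ (Covering.hub (≢-sym p≢q) (nonEdges≡v (≢-sym p≢q)) (λ y fy → n≢0⇒n>0 λ e → none (y , fy , e)))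

  -- Two different hubs of p, towards q and towards r, would admit a rotation through p, q and r.
  hub-consistent : ∀ {p q r s s′} → Hub p q s → Hub p r s′ → s ≡ s′
  hub-consistent {p} {q} {r} {s} {s′} Hs Hs′ with q ≟ᶠ r | s ≟ᶠ s′
  ... | yes refl | _          = hub-unique Hs Hs′
  ... | no _     | yes s≡s′   = s≡s′
  ... | no q≢r   | no s≢s′   = rotate (arc-connex q≢r)
    where
    p≢q : p ≢ q
    p≢q = hub-blocks-distinct Hs
    p≢r : p ≢ r
    p≢r = hub-blocks-distinct Hs′
    s′-adj : ∀ {b} y → f y ≡ q → y ≢ b → adj G s′ y ≡ true
    s′-adj y fy _ = hub-adjacent Hs (Hub.in-block Hs′) fy (≢-sym s≢s′)
    rotate : Arc q r ⊎ Arc r q → s ≡ s′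
    rotate (inj₁ (t , Ht)) with another-in-block q t | block-inhabited r
    ... | b , fb , b≢t | z , fz = ⊥-elim (Rotation.impossible p≢q q≢r (≢-sym p≢r)
          (Hub.in-block Hs′) fb fz s′-adj
          (λ z′ fz′ _ → hub-adjacent Ht fb fz′ b≢t)
          (λ x fx x≢s′ → trans (adj-sym z x) (hub-adjacent Hs′ fx fz x≢s′)))
    rotate (inj₂ (u , Hu)) with block-inhabited q
    ... | b , fb = ⊥-elim (Rotation.impossible p≢q q≢r (≢-sym p≢r)
          (Hub.in-block Hs′) fb (Hub.in-block Hu) s′-adj
          (λ z fz z≢u → trans (adj-sym b z) (hub-adjacent Hu fz fb z≢u))
          (λ x fx x≢s′ → trans (adj-sym u x) (hub-adjacent Hs′ fx (Hub.in-block Hu) x≢s′)))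

  hub? : ∀ p q c → Dec (Hub p q c)
  hub? p q c = map′
    (λ (fc , nonadj , sole) → record
      { in-block = fc ; nonadjacent = λ {y} → nonadj y ; sole = λ {x} {y} → sole x y })
    (λ H → Hub.in-block H , (λ y → Hub.nonadjacent H {y}) , (λ x y → Hub.sole H {x} {y}))
    ((f c ≟ᶠ p)
      ×-dec all? (λ y → (f y ≟ᶠ q) →-dec (adj G c y ≟ᵇ false))
      ×-dec all? (λ x → all? (λ y →
              (f x ≟ᶠ p) →-dec ((f y ≟ᶠ q) →-dec ((adj G x y ≟ᵇ false) →-dec (x ≟ᶠ c))))))

  arc? : ∀ p q → Dec (Arc p q)
  arc? p q = any? (hub? p q)

  arc-irrefl : ∀ {p} → ¬ Arc p p
  arc-irrefl (_ , H) = hub-blocks-distinct H refl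

  arc-trans : ∀ {p q r} → Arc p q → Arc q r → Arc p r
  arc-trans {p} {q} {r} (a , Ha) (b , Hb) with p ≟ᶠ r
  ... | yes refl = ⊥-elim (hub-asym Ha Hb)
  ... | no  p≢r with arc-connex p≢r
  ...   | inj₁ arc       = arc
  ...   | inj₂ (c , Hc) = ⊥-elim (no-hub-cycle Ha Hb Hc)

  module Ranking = Position arc? arc-irrefl arc-trans arc-connex (λ _ → true)

  rank : Fin n → ℕ
  rank = Ranking.position

  rank<n : ∀ p → rank p < n
  rank<n p = subst (rank p <_) (trans (sumFin-const n 1) (*-identityʳ n)) (Ranking.position<count refl)

  opaque
    centre : Fin n → Fin (n * v)
    centre p with any? (arc? p)
    ... | yes (_ , c , _) = c
    ... | no  _           = proj₁ (block-inhabited p)  -- the last block: any vertex will do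

    centre-in-block : ∀ p → f (centre p) ≡ p
    centre-in-block p with any? (arc? p)
    ... | yes (_ , _ , H) = Hub.in-block H
    ... | no  _           = proj₂ (block-inhabited p)

    centre-hub : ∀ {p q c} → Hub p q c → centre p ≡ c
    centre-hub {p} {q} H with any? (arc? p)
    ... | yes (_ , _ , H′) = hub-consistent H′ H
    ... | no  none         = ⊥-elim (none (q , _ , H))

  -- Ordering vertices by key puts the centre of each block first within its block.
  key : Fin (n * v) → ℕ
  key x = if x == centre (f x) then toℕ x else n * v + toℕ x

  key-injective : ∀ {x y} → key x ≡ key y → x ≡ y
  key-injective {x} {y} eq with x == centre (f x) | y == centre (f y)
  ... | true  | true  = toℕ-injective eq
  ... | false | false = toℕ-injective (+-cancelˡ-≡ (n * v) _ _ eq)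
  ... | true  | false = ⊥-elim (<⇒≱ (toℕ<n x) (≤-trans (m≤m+n (n * v) (toℕ y)) (≤-reflexive (sym eq))))
  ... | false | true  = ⊥-elim (<⇒≱ (toℕ<n y) (≤-trans (m≤m+n (n * v) (toℕ x)) (≤-reflexive eq)))

  key-connex : ∀ {x y} → x ≢ y → key x < key y ⊎ key y < key x
  key-connex {x} {y} x≢y with <-cmp (key x) (key y)
  ... | tri< lt _ _ = inj₁ lt
  ... | tri≈ _ eq _ = ⊥-elim (x≢y (key-injective eq))
  ... | tri> _ _ gt = inj₂ gt

  module Indexing (p : Fin n) =
    Position (λ x y → key x <? key y) (<-irrefl refl) <-trans key-connex (λ z → f z == p)

  index : Fin (n * v) → ℕ
  index x = Indexing.position (f x) x

  index<v : ∀ x → index x < v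
  index<v x = subst (index x <_) (block-size (f x)) (Indexing.position<count (f x) (==-true refl))

  index-injective : ∀ {x y} → f x ≡ f y → index x ≡ index y → x ≡ y
  index-injective {x} {y} fx≡fy eq = Indexing.position-injective (f x) (==-true refl) (==-true (sym fx≡fy))
    (trans eq (cong (λ p → Indexing.position p y) (sym fx≡fy)))

  key-centre : ∀ p → key (centre p) ≡ toℕ (centre p)
  key-centre p rewrite ==-true (sym (cong centre (centre-in-block p))) = refl

  key-other : ∀ {x} → x ≢ centre (f x) → key x ≡ n * v + toℕ x
  key-other x≢c rewrite ==-false x≢c = refl

  centre<other : ∀ {x} → x ≢ centre (f x) → key (centre (f x)) < key x
  centre<other {x} x≢c = begin-strict
    key (centre (f x))       ≡⟨ key-centre (f x) ⟩
    toℕ (centre (f x))       <⟨ toℕ<n (centre (f x)) ⟩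
    n * v                    ≤⟨ m≤m+n (n * v) (toℕ x) ⟩
    n * v + toℕ x            ≡⟨ key-other x≢c ⟨
    key x                    ∎
    where open ≤-Reasoning

  index-centre : ∀ p → index (centre p) ≡ 0
  index-centre p = Indexing.position-minimum (f (centre p)) {centre p} minimal
    where
    minimal : ∀ z → f z == f (centre p) ≡ true → ¬ key z < key (centre p)
    minimal z fz≡ = by-cases (z ≟ᶠ centre (f z))
      where
      fz≡p : f z ≡ p
      fz≡p = trans (==-sound fz≡) (centre-in-block p)
      by-cases : Dec (z ≡ centre (f z)) → ¬ key z < key (centre p)
      by-cases (yes z≡c) = <-irrefl (cong key (trans z≡c (cong centre fz≡p)))
      by-cases (no  z≢c) = <⇒≯ (subst (_< key z) (cong (key ∘ centre) fz≡p) (centre<other z≢c))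

  index-other : ∀ {x} → x ≢ centre (f x) → 0 < index x
  index-other {x} x≢c = ≤-trans z<s
    (Indexing.position-mono (f x) {centre (f x)} {x} (==-true (centre-in-block (f x))) (centre<other x≢c))

  opaque
    rankᶠ : Fin n → Fin n
    rankᶠ p = fromℕ< (rank<n p)

    toℕ-rankᶠ : ∀ p → toℕ (rankᶠ p) ≡ rank p
    toℕ-rankᶠ p = toℕ-fromℕ< (rank<n p)

    indexᶠ : Fin (n * v) → Fin v
    indexᶠ x = fromℕ< (index<v x)

    toℕ-indexᶠ : ∀ x → toℕ (indexᶠ x) ≡ index x
    toℕ-indexᶠ x = toℕ-fromℕ< (index<v x)

  σ : Fin (n * v) → Fin n × Fin v
  σ x = rankᶠ (f x) , indexᶠ x

  rankᶠ-injective : ∀ {p q} → rankᶠ p ≡ rankᶠ q → p ≡ q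
  rankᶠ-injective {p} {q} eq = Ranking.position-injective refl refl
    (trans (sym (toℕ-rankᶠ p)) (trans (cong toℕ eq) (toℕ-rankᶠ q)))

  σ-injective : ∀ {x y} → σ x ≡ σ y → x ≡ y
  σ-injective {x} {y} eq = index-injective fx≡fy
    (trans (sym (toℕ-indexᶠ x)) (trans (cong (toℕ ∘ proj₂) eq) (toℕ-indexᶠ y)))
    where
    fx≡fy : f x ≡ f y
    fx≡fy = rankᶠ-injective (cong proj₁ eq)

  σ-surjective : ∀ P → ∃ λ x → σ x ≡ P
  σ-surjective P = proj₁ preimage , uncurry-combine-injective (proj₂ preimage)
    where
    preimage : ∃ λ x → uncurry combine (σ x) ≡ uncurry combine P
    preimage = injective⇒surjective (uncurry combine ∘ σ) (σ-injective ∘ uncurry-combine-injective)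
                                    (uncurry combine P)

  adj-across : ∀ {x y} → Arc (f x) (f y) → adj G x y ≡ Γadj (σ x) (σ y)
  adj-across {x} {y} (c , H) = begin
    adj G x y                         ≡⟨ adj-via-hub (x ≟ᶠ c) ⟩
    not (index x ≡ᵇ 0)                ≡⟨ cong (λ k → not (k ≡ᵇ 0)) (toℕ-indexᶠ x) ⟨
    not (toℕ (indexᶠ x) ≡ᵇ 0)          ≡⟨ Γadj-lower-row (indexᶠ x) (indexᶠ y) rank-lower ⟨
    Γadj (σ x) (σ y)                  ∎
    where
    open ≡-Reasoning
    rank-lower : toℕ (rankᶠ (f x)) < toℕ (rankᶠ (f y))
    rank-lower = subst₂ _<_ (sym (toℕ-rankᶠ (f x))) (sym (toℕ-rankᶠ (f y)))
      (Ranking.position-mono refl (c , H))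
    positive : ∀ {m} → 0 < m → (m ≡ᵇ 0) ≡ false
    positive {suc m} _ = refl
    adj-via-hub : Dec (x ≡ c) → adj G x y ≡ not (index x ≡ᵇ 0)
    adj-via-hub (yes refl) rewrite Hub.nonadjacent H {y} refl
                                 | sym (centre-hub H) | index-centre (f x) = refl
    adj-via-hub (no x≢c) = trans (hub-adjacent H refl refl x≢c)
      (sym (cong not (positive (index-other λ x≡centre → x≢c (trans x≡centre (centre-hub H))))))

  adj-σ : ∀ x y → adj G x y ≡ Γadj (σ x) (σ y)
  adj-σ x y with x ≟ᶠ y
  ... | yes refl = trans (Graph.irrefl G x) (sym (Graph.irrefl (Γ′ n v) (σ x)))
  ... | no  x≢y with f x ≟ᶠ f y
  ...   | yes fx≡fy = trans (block-clique x y fx≡fy x≢y)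
            (sym (subst (λ r → Γadj (σ x) (r , indexᶠ y) ≡ true) (cong rankᶠ fx≡fy)
              (Γadj-same-row (rankᶠ (f x)) (indexᶠ x) (indexᶠ y)
                λ eq → x≢y (σ-injective (cong₂ _,_ (cong rankᶠ fx≡fy) eq)))))
  ...   | no  fx≢fy with arc-connex fx≢fy
  ...     | inj₁ arc = adj-across arc
  ...     | inj₂ arc = trans (adj-sym x y) (trans (adj-across arc) (Graph.sym (Γ′ n v) (σ y) (σ x)))

  isomorphism : G ≅ Γ′ n v
  isomorphism = mk⤖ {to = σ}
    (σ-injective , λ P → proj₁ (σ-surjective P) , λ z≡x → trans (cong σ z≡x) (proj₂ (σ-surjective P)))
    , adj-σ

theorem3p6 : (n v : ℕ) → n ≥ 2 → v ≥ 2 → (G : Graph (Fin (n * v))) →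
    MaximalWeaklyCliquePartitioned n v G → G ≅ Γ′ n v
theorem3p6 n v _ v≥2 G ((f , f-partition , f-unique) , edges) =
  Maximal.isomorphism v≥2 G f f-partition f-unique edges
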